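{- In a precubic unicellular map, considered with its canonical orientation convention, every two-ways edge is incident to left corners only and is not a twist.
   Context: A map is an embedding of a connected finite graph (loops and multiple edges allowed) into a compact connected surface with simply connected faces, up to homeomorphism; it is rooted by a distinguished half-edge with a distinguished side (root corner on that side; root vertex its vertex). A corner is an angular sector at a vertex between two consecutive half-edges. A map is unicellular if it has one face; precubic if all vertices have degree $1$ or $3$ and the root vertex has degree $1$. The tour follows the edges from the root corner along the distinguished side until returning; an edge is two-ways if it is followed in both directions during the tour, one-way otherwise. An orientation convention is a choice of local orientation near each vertex; an edge is a twist if the local orientations at its endpoints do not extend to an orientation of a neighbourhood of the edge. A corner is left if it lies to the left of the walker during the tour, right otherwise. The canonical convention of a precubic unicellular map is the unique one in which every vertex has more left corners than right corners. -}

module Defs where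

-- Combinatorial maps on (possibly non-orientable) surfaces, encoded by flags
-- (= half-edge sides), in the standard way: three fixed-point-free involutions
--   α0 : moves a flag to the other end of its edge, same side of the edge;
--   α1 : moves a flag across its corner to the next half-edge at the same vertex;
--   α2 : moves a flag to the other side of the same half-edge.
-- Vertices = orbits of ⟨α1,α2⟩, edges = orbits of ⟨α0,α2⟩, faces = orbits of
-- ⟨α0,α1⟩, corners = orbits of ⟨α1⟩ (pairs {g, α1 g}), half-edges = {g, α2 g}.

open import Data.Nat using (ℕ; zero; suc; _+_; _<_)
open import Data.Nat.DivMod using (_/_)
open import Data.Fin using (Fin; _≟_)
open import Data.Bool using (Bool; true; false; T; _∧_; _∨_; not; if_then_else_)
open import Data.List using (List; map; allFin; upTo)
open import Data.Nat.ListAction using (sum)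
open import Data.Bool.ListAction using (any)
open import Data.Product using (Σ; ∃; ∃-syntax; _×_)
open import Data.Sum using (_⊎_)
open import Relation.Nullary using (¬_)
open import Relation.Nullary.Decidable using (⌊_⌋)
open import Relation.Binary.PropositionalEquality using (_≡_; _≢_)

iter : {A : Set} → ℕ → (A → A) → A → A
iter zero    h x = x
iter (suc k) h x = h (iter k h x)

data Reach {n : ℕ} (a0 a1 a2 : Fin n → Fin n) : Fin n → Fin n → Set where
  here : ∀ {f} → Reach a0 a1 a2 f f
  via0 : ∀ {f g} → Reach a0 a1 a2 f g → Reach a0 a1 a2 f (a0 g)
  via1 : ∀ {f g} → Reach a0 a1 a2 f g → Reach a0 a1 a2 f (a1 g)
  via2 : ∀ {f g} → Reach a0 a1 a2 f g → Reach a0 a1 a2 f (a2 g)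

-- A rooted map with n flags.  The root flag is the root half-edge together
-- with its distinguished side; the root corner is the corner {root, α1 root}.
record Map (n : ℕ) : Set where
  field
    α0 α1 α2  : Fin n → Fin n
    α0-invol  : ∀ f → α0 (α0 f) ≡ f
    α1-invol  : ∀ f → α1 (α1 f) ≡ f
    α2-invol  : ∀ f → α2 (α2 f) ≡ f
    α0-fpf    : ∀ f → α0 f ≢ f
    α1-fpf    : ∀ f → α1 f ≢ f
    α2-fpf    : ∀ f → α2 f ≢ f
    α0α2-comm : ∀ f → α0 (α2 f) ≡ α2 (α0 f)
    α0α2-fpf  : ∀ f → α0 (α2 f) ≢ f
    connected : ∀ f g → Reach α0 α1 α2 f g
    root      : Fin n

module _ {n : ℕ} (M : Map n) where
  open Map M

  -- walking step along the face: traverse the edge, then turn around the corner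
  φ : Fin n → Fin n
  φ f = α1 (α0 f)

  ρ : Fin n → Fin n
  ρ f = α2 (α1 f)

  _==_ : Fin n → Fin n → Bool
  f == g = ⌊ f ≟ g ⌋

  countFlags : (Fin n → Bool) → ℕ
  countFlags p = sum (map (λ g → if p g then 1 else 0) (allFin n))

  -- one face: ⟨α0,α1⟩ acts transitively (its orbit of the root is everything)
  Unicellular : Set
  Unicellular = ∀ g → ∃[ k ] (iter k φ root ≡ g ⊎ iter k φ (α0 root) ≡ g)

  -- g lies at the same vertex as f (⟨α1,α2⟩-orbit; the orbit has < n
  -- elements of each dihedral type, so bounded search is exhaustive)
  sameVertex? : Fin n → Fin n → Bool
  sameVertex? f g = any (λ k → (iter k ρ f == g) ∨ (iter k ρ (α1 f) == g)) (upTo n)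

  -- degree of the vertex of flag v = number of half-edges there
  --   = (number of flags at the vertex) / 2
  degree : Fin n → ℕ
  degree v = countFlags (sameVertex? v) / 2

  Precubic : Set
  Precubic = (∀ v → degree v ≡ 1 ⊎ degree v ≡ 3) × degree root ≡ 1

  -- the tour: starting from the root corner, departing along the root
  -- half-edge on the distinguished side; its "departure flags" are the
  -- φ-orbit of the root flag (a departure flag d = the walker leaves the
  -- vertex along the half-edge {d, α2 d} with the face on the side of d).
  departs? : Fin n → Bool
  departs? g = any (λ k → iter k φ root == g) (upTo n)

  Departure : Fin n → Set
  Departure g = T (departs? g)

  InEdge : Fin n → Fin n → Set
  InEdge f g = g ≡ f ⊎ g ≡ α0 f ⊎ g ≡ α2 f ⊎ g ≡ α0 (α2 f)

  SameHalfEdge : Fin n → Fin n → Set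
  SameHalfEdge d d' = d' ≡ d ⊎ d' ≡ α2 d

  -- the edge of f is two-ways: it is followed by the tour in both directions,
  -- i.e. it is departed along from both of its half-edges
  TwoWays : Fin n → Set
  TwoWays f = Σ (Fin n) λ d → Σ (Fin n) λ d' →
    InEdge f d × InEdge f d' × Departure d × Departure d' × ¬ SameHalfEdge d d'

  -- Orientation convention: a choice of local orientation at every vertex,
  -- encoded as the set of flags lying on the positive (counterclockwise) side
  -- of their half-edge; α1 and α2 reverse this within a vertex.
  record Convention : Set where
    field
      pos    : Fin n → Bool
      flip-1 : ∀ f → pos (α1 f) ≢ pos f
      flip-2 : ∀ f → pos (α2 f) ≢ pos f

  module _ (c : Convention) where
    open Convention c

    -- The corner {g, α1 g} is passed by the walker between arriving along one
    -- half-edge and departing (departure flag d ∈ {g, α1 g}); it is on the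
    -- walker's left iff the face side d is the positive side of its half-edge.
    leftCorner? : Fin n → Bool
    leftCorner? g = (departs? g ∧ pos g) ∨ (departs? (α1 g) ∧ pos (α1 g))

    rightCorner? : Fin n → Bool
    rightCorner? g = (departs? g ∧ not (pos g)) ∨ (departs? (α1 g) ∧ not (pos (α1 g)))

    LeftCorner : Fin n → Set
    LeftCorner g = T (leftCorner? g)

    -- twice the number of left / right corners at the vertex of v
    -- (each corner has exactly two flags, both at that vertex)
    leftCount rightCount : Fin n → ℕ
    leftCount  v = countFlags (λ g → sameVertex? v g ∧ leftCorner? g)
    rightCount v = countFlags (λ g → sameVertex? v g ∧ rightCorner? g)

    Canonical : Set
    Canonical = ∀ v → rightCount v < leftCount v

    -- the edge of f is a twist: the local orientations at its two ends do not
    -- extend across it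
    Twist : Fin n → Set
    Twist f = pos (α0 f) ≡ pos f

module Submission where

-- The tour never visits both a flag x and α0 x (nor x and α1 x): if φᵏ x = α0 x
-- then applying φ⁻¹ = α0 α1 gives φᵏ⁻² (φ x) = α0 (φ x), and descending on k
-- ends in a fixed point of α0 or α1.  So no corner is both left and right.
-- If a two-ways edge were followed along a negative side d, then both corners
-- {d, α1 d} and {α2 d, α1 α2 d} at the vertex of d would be right corners: a
-- vertex of degree 1 would have only a right corner, and a vertex of degree 3
-- would have at least two right corners among its three.  Either way the
-- canonical convention is violated, so both followed sides are positive; this
-- makes the four corners of the edge left ones and its ends' orientations agree.

open import Defs
open import Algebra.Properties.CommutativeSemigroup using (interchange)
open import Data.Bool using (Bool; true; false; T; _∧_; _∨_; not; if_then_else_)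
open import Data.Bool.Properties using (T-∧; T-∨; T-≡; T-not-≡; ¬-not; not-involutive)
open import Data.Empty using (⊥; ⊥-elim)
open import Data.Fin using (Fin; toℕ; _≟_)
open import Data.Fin.Properties using (pigeonhole; toℕ<n)
open import Data.List using (List; []; _∷_; length; map; upTo; allFin)
open import Data.List.Membership.Propositional using (_∈_; lose)
open import Data.List.Membership.Propositional.Properties using (∈-upTo⁺; ∈-allFin)
open import Data.List.Relation.Unary.All as All using (All; []; _∷_)
open import Data.List.Relation.Unary.AllPairs using ([]; _∷_)
open import Data.List.Relation.Unary.Any using (here; there; satisfied)
open import Data.List.Relation.Unary.Any.Properties using (any⁺; any⁻)
open import Data.List.Relation.Unary.Unique.Propositional using (Unique)
open import Data.Nat using (ℕ; zero; suc; _+_; _≤_; _<_; z≤n; s≤s)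
open import Data.Nat.DivMod using (/-monoˡ-≤)
open import Data.Nat.ListAction using (sum)
open import Data.Nat.Properties
  using ( ≤-refl; ≤-reflexive; ≤-trans; <-irrefl; +-comm; +-suc; +-mono-≤; m≤m+n; m≤n+m
        ; ≤-total; m≤n⇒∃[o]m+o≡n; m≤n⇒m<n∨m≡n; n<1+n; ≤-pred; ≤⇒≯; ≰⇒>
        ; +-commutativeSemigroup; module ≤-Reasoning)
open import Data.Product using (∃-syntax; _×_; _,_; proj₁; proj₂)
open import Data.Sum using (_⊎_; inj₁; inj₂)
import Data.Sum as Sum
open import Data.Unit using (tt)
open import Function using (_∘_)
open import Function.Bundles using (Equivalence)
open import Relation.Binary.Definitions using (DecidableEquality)
open import Relation.Binary.PropositionalEquality
open import Relation.Nullary using (¬_)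
open import Relation.Nullary.Decidable using (⌊_⌋; toWitness; fromWitness; fromWitnessFalse)

open Equivalence using (to; from)

module Counting {A : Set} where

  indicator : Bool → ℕ
  indicator b = if b then 1 else 0

  count : (A → Bool) → List A → ℕ
  count p xs = sum (map (indicator ∘ p) xs)

  indicator-mono : ∀ {a b} → (T a → T b) → indicator a ≤ indicator b
  indicator-mono {false} _ = z≤n
  indicator-mono {true} {true} _ = ≤-refl
  indicator-mono {true} {false} a⇒b = ⊥-elim (a⇒b tt)

  indicator-∨ : ∀ {a b} → (T a → T b → ⊥) → indicator (a ∨ b) ≡ indicator a + indicator b
  indicator-∨ {true} {true} disjoint = ⊥-elim (disjoint tt tt)
  indicator-∨ {true} {false} _ = refl
  indicator-∨ {false} _ = refl

  count-mono : ∀ {p q : A → Bool} → (∀ x → T (p x) → T (q x)) →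
               ∀ xs → count p xs ≤ count q xs
  count-mono p⇒q [] = z≤n
  count-mono p⇒q (x ∷ xs) = +-mono-≤ (indicator-mono (p⇒q x)) (count-mono p⇒q xs)

  count-∨ : ∀ {p q : A → Bool} → (∀ x → T (p x) → T (q x) → ⊥) →
            ∀ xs → count (λ x → p x ∨ q x) xs ≡ count p xs + count q xs
  count-∨ disjoint [] = refl
  count-∨ {p} {q} disjoint (x ∷ xs) = begin
    indicator (p x ∨ q x) + count (λ x → p x ∨ q x) xs
      ≡⟨ cong₂ _+_ (indicator-∨ (disjoint x)) (count-∨ disjoint xs) ⟩
    (indicator (p x) + indicator (q x)) + (count p xs + count q xs)
      ≡⟨ interchange +-commutativeSemigroup (indicator (p x)) _ _ _ ⟩
    (indicator (p x) + count p xs) + (indicator (q x) + count q xs) ∎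
    where open ≡-Reasoning

  count-pos : ∀ {p : A → Bool} {x xs} → x ∈ xs → T (p x) → 1 ≤ count p xs
  count-pos {p} (here refl) px = +-mono-≤ (indicator-mono {b = p _} (λ _ → px)) z≤n
  count-pos {p} {xs = y ∷ _} (there x∈xs) px =
    ≤-trans (count-pos x∈xs px) (m≤n+m _ (indicator (p y)))

  module _ (_≟ᴬ_ : DecidableEquality A) {xs : List A} (complete : ∀ x → x ∈ xs) where

    length≤count : ∀ {p : A → Bool} {ys} → Unique ys → All (T ∘ p) ys →
                   length ys ≤ count p xs
    length≤count [] [] = z≤n
    length≤count {p} {y ∷ ys} (y∉ys ∷ unique) (py ∷ pys) = begin
      1 + length ys                 ≤⟨ +-mono-≤ (count-pos (complete y) (fromWitness refl))
                                                (length≤count unique (All.zipWith p∧≢y (pys , y∉ys))) ⟩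
      count is-y xs + count p∖y xs  ≡⟨ count-∨ disjoint xs ⟨
      count (λ x → is-y x ∨ p∖y x) xs ≤⟨ count-mono covered xs ⟩
      count p xs                    ∎
      where
      open ≤-Reasoning
      is-y p∖y : A → Bool
      is-y x = ⌊ x ≟ᴬ y ⌋
      p∖y x = p x ∧ not (is-y x)

      p∧≢y : ∀ {x} → T (p x) × y ≢ x → T (p∖y x)
      p∧≢y (px , y≢x) = from T-∧ (px , fromWitnessFalse (y≢x ∘ sym))

      disjoint : ∀ x → T (is-y x) → T (p∖y x) → ⊥
      disjoint x x≡y px∖y with is-y x
      ... | true = proj₂ (to T-∧ px∖y)

      covered : ∀ x → T (is-y x ∨ p∖y x) → T (p x)
      covered x h with to T-∨ h
      ... | inj₁ x≡y = subst (T ∘ p) (sym (toWitness x≡y)) py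
      ... | inj₂ px = proj₁ (to T-∧ px)

open Counting

module _ {A : Set} (h : A → A) where

  iter-+ : ∀ a b x → iter (a + b) h x ≡ iter a h (iter b h x)
  iter-+ zero b x = refl
  iter-+ (suc a) b x = cong h (iter-+ a b x)

  iter-suc : ∀ k x → iter (suc k) h x ≡ iter k h (h x)
  iter-suc zero x = refl
  iter-suc (suc k) x = cong h (iter-suc k x)

  iter-fixed : ∀ {x} → h x ≡ x → ∀ k → iter k h x ≡ x
  iter-fixed hx≡x zero = refl
  iter-fixed hx≡x (suc k) = trans (cong h (iter-fixed hx≡x k)) hx≡x

  iter-from : ∀ {r x} a o → iter a h r ≡ x → iter (a + o) h r ≡ iter o h x
  iter-from {r} {x} a o hᵃr≡x = begin
    iter (a + o) h r      ≡⟨ cong (λ m → iter m h r) (+-comm a o) ⟩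
    iter (o + a) h r      ≡⟨ iter-+ o a r ⟩
    iter o h (iter a h r) ≡⟨ cong (iter o h) hᵃr≡x ⟩
    iter o h x            ∎
    where open ≡-Reasoning

  orbit-avoids-ι-pairs : (ι : A → A) → (∀ x → ι (ι x) ≡ x) → (∀ k x → iter k h x ≢ ι x) →
                 ∀ {r x} a b → iter a h r ≡ x → iter b h r ≡ ι x → ⊥
  orbit-avoids-ι-pairs ι ι-invol avoids a b hᵃr≡x hᵇr≡ιx with ≤-total a b
  ... | inj₁ a≤b with o , refl ← m≤n⇒∃[o]m+o≡n a≤b =
    avoids o _ (trans (sym (iter-from a o hᵃr≡x)) hᵇr≡ιx)
  ... | inj₂ b≤a with o , refl ← m≤n⇒∃[o]m+o≡n b≤a =
    avoids o _ (trans (sym (iter-from b o hᵇr≡ιx)) (trans hᵃr≡x (sym (ι-invol _))))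

module Orbit {n : ℕ} (σ τ : Fin n → Fin n) (τ∘σ : ∀ x → τ (σ x) ≡ x) where

  σ-injective : ∀ {x y} → σ x ≡ σ y → x ≡ y
  σ-injective {x} {y} σx≡σy = trans (sym (τ∘σ x)) (trans (cong τ σx≡σy) (τ∘σ y))

  iter-cancel : ∀ a {x} o → iter a σ x ≡ iter (a + suc o) σ x → iter (suc o) σ x ≡ x
  iter-cancel zero o eq = sym eq
  iter-cancel (suc a) o eq = iter-cancel a o (σ-injective eq)

  period : ∀ x → ∃[ p ] p < n × iter (suc p) σ x ≡ x
  period x with pigeonhole (n<1+n n) (λ i → iter (toℕ i) σ x)
  ... | i , j , i<j , eq with m≤n⇒∃[o]m+o≡n i<j
  ... | o , 1+i+o≡j =
    o , o<n , iter-cancel (toℕ i) o (trans eq (cong (λ m → iter m σ x) j≡i+1+o))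
    where
    j≡i+1+o : toℕ j ≡ toℕ i + suc o
    j≡i+1+o = trans (sym 1+i+o≡j) (sym (+-suc (toℕ i) o))
    o<n : o < n
    o<n = ≤-trans (s≤s (m≤n+m o (toℕ i))) (subst (_≤ n) (sym 1+i+o≡j) (≤-pred (toℕ<n j)))

  iter-mod-period : ∀ {x p} → iter (suc p) σ x ≡ x →
                    ∀ k → ∃[ m ] m ≤ p × iter m σ x ≡ iter k σ x
  iter-mod-period per zero = 0 , z≤n , refl
  iter-mod-period per (suc k) with iter-mod-period per k
  ... | m , m≤p , eq with m≤n⇒m<n∨m≡n m≤p
  ... | inj₁ m<p = suc m , m<p , cong σ eq
  ... | inj₂ refl = 0 , z≤n , trans (sym per) (cong σ eq)

  iter-reduce : ∀ x k → ∃[ m ] m < n × iter m σ x ≡ iter k σ x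
  iter-reduce x k with period x
  ... | p , p<n , per with iter-mod-period per k
  ... | m , m≤p , eq = m , ≤-trans (s≤s m≤p) p<n , eq

  inverse-in-orbit : ∀ x → ∃[ p ] iter p σ x ≡ τ x
  inverse-in-orbit x with p , _ , per ← period x = p , trans (sym (τ∘σ _)) (cong τ per)

module MapProperties {n : ℕ} (M : Map n) where
  open Map M

  α1-injective : ∀ {x y} → α1 x ≡ α1 y → x ≡ y
  α1-injective {x} {y} eq = trans (sym (α1-invol x)) (trans (cong α1 eq) (α1-invol y))

  α2α0α2≡α0 : ∀ x → α2 (α0 (α2 x)) ≡ α0 x
  α2α0α2≡α0 x = trans (sym (α0α2-comm (α2 x))) (cong α0 (α2-invol x))

  α0α2-invol : ∀ x → α0 (α2 (α0 (α2 x))) ≡ x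
  α0α2-invol x = trans (cong α0 (α2α0α2≡α0 x)) (α0-invol x)

  InEdge-sym : ∀ {f g} → InEdge M f g → InEdge M g f
  InEdge-sym {f} (inj₁ refl) = inj₁ refl
  InEdge-sym {f} (inj₂ (inj₁ refl)) = inj₂ (inj₁ (sym (α0-invol f)))
  InEdge-sym {f} (inj₂ (inj₂ (inj₁ refl))) = inj₂ (inj₂ (inj₁ (sym (α2-invol f))))
  InEdge-sym {f} (inj₂ (inj₂ (inj₂ refl))) = inj₂ (inj₂ (inj₂ (sym (α0α2-invol f))))

  InEdge-α0 : ∀ {f g} → InEdge M f g → InEdge M f (α0 g)
  InEdge-α0 {f} (inj₁ refl) = inj₂ (inj₁ refl)
  InEdge-α0 {f} (inj₂ (inj₁ refl)) = inj₁ (α0-invol f)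
  InEdge-α0 {f} (inj₂ (inj₂ (inj₁ refl))) = inj₂ (inj₂ (inj₂ refl))
  InEdge-α0 {f} (inj₂ (inj₂ (inj₂ refl))) = inj₂ (inj₂ (inj₁ (α0-invol (α2 f))))

  InEdge-α2 : ∀ {f g} → InEdge M f g → InEdge M f (α2 g)
  InEdge-α2 {f} (inj₁ refl) = inj₂ (inj₂ (inj₁ refl))
  InEdge-α2 {f} (inj₂ (inj₁ refl)) = inj₂ (inj₂ (inj₂ (sym (α0α2-comm f))))
  InEdge-α2 {f} (inj₂ (inj₂ (inj₁ refl))) = inj₁ (α2-invol f)
  InEdge-α2 {f} (inj₂ (inj₂ (inj₂ refl))) = inj₂ (inj₁ (α2α0α2≡α0 f))

  InEdge-elim : (P : Fin n → Set) → (∀ {x} → P x → P (α0 x)) → (∀ {x} → P x → P (α2 x)) →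
                ∀ {f g} → P f → InEdge M f g → P g
  InEdge-elim P P-α0 P-α2 pf (inj₁ refl) = pf
  InEdge-elim P P-α0 P-α2 pf (inj₂ (inj₁ refl)) = P-α0 pf
  InEdge-elim P P-α0 P-α2 pf (inj₂ (inj₂ (inj₁ refl))) = P-α2 pf
  InEdge-elim P P-α0 P-α2 pf (inj₂ (inj₂ (inj₂ refl))) = P-α0 (P-α2 pf)

  InEdge-euclidean : ∀ {f d e} → InEdge M f d → InEdge M f e → InEdge M d e
  InEdge-euclidean {d = d} f~d = InEdge-elim (InEdge M d) InEdge-α0 InEdge-α2 (InEdge-sym f~d)

  ψ : Fin n → Fin n
  ψ x = α0 (α1 x)

  ψ∘φ : ∀ x → ψ (φ M x) ≡ x
  ψ∘φ x = trans (cong α0 (α1-invol (α0 x))) (α0-invol x)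

  φ-orbit-avoids-α0 : ∀ k x → iter k (φ M) x ≢ α0 x
  φ-orbit-avoids-α0 zero x x≡α0x = α0-fpf x (sym x≡α0x)
  φ-orbit-avoids-α0 (suc zero) x φx≡α0x = α1-fpf (α0 x) φx≡α0x
  φ-orbit-avoids-α0 (suc (suc k)) x eq = φ-orbit-avoids-α0 k (φ M x) (begin
    iter k (φ M) (φ M x)             ≡⟨ iter-suc (φ M) k x ⟨
    iter (suc k) (φ M) x             ≡⟨ ψ∘φ _ ⟨
    ψ (iter (suc (suc k)) (φ M) x)   ≡⟨ cong ψ eq ⟩
    α0 (φ M x)                       ∎)
    where open ≡-Reasoning

  φ-orbit-avoids-α1 : ∀ k x → iter k (φ M) x ≢ α1 x
  φ-orbit-avoids-α1 zero x x≡α1x = α1-fpf x (sym x≡α1x)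
  φ-orbit-avoids-α1 (suc k) x eq =
    φ-orbit-avoids-α0 k x (Orbit.σ-injective (φ M) ψ ψ∘φ (trans eq (cong α1 (sym (α0-invol x)))))

  departure⇒iter : ∀ {g} → Departure M g → ∃[ k ] iter k (φ M) root ≡ g
  departure⇒iter dep with k , found ← satisfied (any⁻ _ (upTo n) dep) = k , toWitness found

  iter⇒departure : ∀ k → Departure M (iter k (φ M) root)
  iter⇒departure k with m , m<n , eq ← Orbit.iter-reduce (φ M) ψ ψ∘φ root k =
    any⁺ _ (lose (∈-upTo⁺ m<n) (fromWitness eq))

  departure-φ : ∀ {g} → Departure M g → Departure M (φ M g)
  departure-φ dep with k , refl ← departure⇒iter dep = iter⇒departure (suc k)

  departure-α1α2 : ∀ {x} → Departure M (α0 (α2 x)) → Departure M (α1 (α2 x))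
  departure-α1α2 {x} dep = subst (Departure M) (cong α1 (α0-invol (α2 x))) (departure-φ dep)

  departure-α0-exclusive : ∀ {g} → Departure M g → Departure M (α0 g) → ⊥
  departure-α0-exclusive dg dα0g with a , eqa ← departure⇒iter dg
                                   | b , eqb ← departure⇒iter dα0g =
    orbit-avoids-ι-pairs (φ M) α0 α0-invol φ-orbit-avoids-α0 a b eqa eqb

  departure-α1-exclusive : ∀ {g} → Departure M g → Departure M (α1 g) → ⊥
  departure-α1-exclusive dg dα1g with a , eqa ← departure⇒iter dg
                                   | b , eqb ← departure⇒iter dα1g =
    orbit-avoids-ι-pairs (φ M) α1 α1-invol φ-orbit-avoids-α1 a b eqa eqb

  FollowedBothWays : Fin n → Set
  FollowedBothWays d = Departure M d × Departure M (α0 (α2 d))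

  followedBothWays-opposite : ∀ {d} → FollowedBothWays d → FollowedBothWays (α0 (α2 d))
  followedBothWays-opposite {d} (dep , dep′) =
    dep′ , subst (Departure M) (sym (α0α2-invol d)) dep

  twoWays⇒followedBothWays : ∀ {f} → TwoWays M f → ∃[ d ] InEdge M f d × FollowedBothWays d
  twoWays⇒followedBothWays (d , d′ , f~d , f~d′ , dep , dep′ , apart)
    with InEdge-euclidean f~d f~d′
  ... | inj₁ d′≡d = ⊥-elim (apart (inj₁ d′≡d))
  ... | inj₂ (inj₁ d′≡α0d) = ⊥-elim (departure-α0-exclusive dep (subst (Departure M) d′≡α0d dep′))
  ... | inj₂ (inj₂ (inj₁ d′≡α2d)) = ⊥-elim (apart (inj₂ d′≡α2d))
  ... | inj₂ (inj₂ (inj₂ d′≡α0α2d)) = d , f~d , (dep , subst (Departure M) d′≡α0α2d dep′)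

  ρ-inverse : ∀ x → α1 (α2 (ρ M x)) ≡ x
  ρ-inverse x = trans (cong α1 (α2-invol (α1 x))) (α1-invol x)

  sameVertex-intro : ∀ {v g} k → k < n → iter k (ρ M) v ≡ g ⊎ iter k (ρ M) (α1 v) ≡ g →
                     T (sameVertex? M v g)
  sameVertex-intro {v} {g} k k<n found =
    any⁺ _ (lose (∈-upTo⁺ k<n)
      (from (T-∨ {x = ⌊ iter k (ρ M) v ≟ g ⌋}) (Sum.map fromWitness fromWitness found)))

  sameVertex-iter : ∀ v k → T (sameVertex? M v (iter k (ρ M) v))
  sameVertex-iter v k with m , m<n , eq ← Orbit.iter-reduce (ρ M) (α1 ∘ α2) ρ-inverse v k =
    sameVertex-intro m m<n (inj₁ eq)

  sameVertex-iter-α1 : ∀ v k → T (sameVertex? M v (iter k (ρ M) (α1 v)))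
  sameVertex-iter-α1 v k with m , m<n , eq ← Orbit.iter-reduce (ρ M) (α1 ∘ α2) ρ-inverse (α1 v) k =
    sameVertex-intro m m<n (inj₂ eq)

  halfEdgeCorners : Fin n → List (Fin n)
  halfEdgeCorners v = v ∷ α1 v ∷ α2 v ∷ α1 (α2 v) ∷ []

  halfEdgeCorners-sameVertex : ∀ v → All (T ∘ sameVertex? M v) (halfEdgeCorners v)
  halfEdgeCorners-sameVertex v
    with p , ρᵖv≡α1α2v ← Orbit.inverse-in-orbit (ρ M) (α1 ∘ α2) ρ-inverse v =
    sameVertex-iter v 0 ∷ sameVertex-iter-α1 v 0 ∷
    subst (T ∘ sameVertex? M v) (cong α2 (α1-invol v)) (sameVertex-iter-α1 v 1) ∷
    subst (T ∘ sameVertex? M v) ρᵖv≡α1α2v (sameVertex-iter v p) ∷ []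

  halfEdgeCorners-unique : ∀ v → α1 v ≢ α2 v → Unique (halfEdgeCorners v)
  halfEdgeCorners-unique v α1v≢α2v =
    (α1-fpf v ∘ sym ∷ α2-fpf v ∘ sym ∷ α1v≢α2v ∘ α1-both ∷ []) ∷
    (α1v≢α2v ∷ α2-fpf v ∘ sym ∘ α1-injective ∷ []) ∷
    (α1-fpf (α2 v) ∘ sym ∷ []) ∷ [] ∷ []
    where
    α1-both : v ≡ α1 (α2 v) → α1 v ≡ α2 v
    α1-both eq = trans (cong α1 eq) (α1-invol (α2 v))

  sameVertex-degree1 : ∀ {v g} → α1 v ≡ α2 v → T (sameVertex? M v g) → g ≡ v ⊎ g ≡ α1 v
  sameVertex-degree1 {v} {g} α1v≡α2v atV with satisfied (any⁻ _ (upTo n) atV)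
  ... | k , found with to (T-∨ {x = ⌊ iter k (ρ M) v ≟ g ⌋}) found
  ... | inj₁ eq = inj₁ (trans (sym (toWitness eq)) (iter-fixed (ρ M) ρv≡v k))
    where
    ρv≡v : ρ M v ≡ v
    ρv≡v = trans (cong α2 α1v≡α2v) (α2-invol v)
  ... | inj₂ eq = inj₂ (trans (sym (toWitness eq)) (iter-fixed (ρ M) ρα1v≡α1v k))
    where
    ρα1v≡α1v : ρ M (α1 v) ≡ α1 v
    ρα1v≡α1v = trans (cong α2 (α1-invol v)) (sym α1v≡α2v)

sign-clash : ∀ {a b} → T (a ∧ b) → T (a ∧ not b) → ⊥
sign-clash {true} {true} _ ()
sign-clash {true} {false} ()

module ConventionProperties {n : ℕ} {M : Map n} (c : Convention M) where
  open Map M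
  open Convention c
  open MapProperties M

  pos-α1 : ∀ x → pos (α1 x) ≡ not (pos x)
  pos-α1 x = ¬-not (flip-1 x)

  pos-α2 : ∀ x → pos (α2 x) ≡ not (pos x)
  pos-α2 x = ¬-not (flip-2 x)

  pos-α1α2 : ∀ x → pos (α1 (α2 x)) ≡ pos x
  pos-α1α2 x = trans (pos-α1 (α2 x)) (trans (cong not (pos-α2 x)) (not-involutive (pos x)))

  pos-α0 : ∀ x → pos (α0 x) ≡ not (pos (α0 (α2 x)))
  pos-α0 x = trans (cong pos (sym (α2α0α2≡α0 x))) (pos-α2 (α0 (α2 x)))

  twist-α0 : ∀ {x} → Twist M c x → Twist M c (α0 x)
  twist-α0 {x} twist = trans (cong pos (α0-invol x)) (sym twist)

  twist-α2 : ∀ {x} → Twist M c x → Twist M c (α2 x)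
  twist-α2 {x} twist = begin
    pos (α0 (α2 x)) ≡⟨ cong pos (α0α2-comm x) ⟩
    pos (α2 (α0 x)) ≡⟨ pos-α2 (α0 x) ⟩
    not (pos (α0 x)) ≡⟨ cong not twist ⟩
    not (pos x)     ≡⟨ pos-α2 x ⟨
    pos (α2 x)      ∎
    where open ≡-Reasoning

  RightCorner : Fin n → Set
  RightCorner g = T (rightCorner? M c g)

  positive-departure-left : ∀ {d} → Departure M d → pos d ≡ true →
                            LeftCorner M c d × LeftCorner M c (α1 d)
  positive-departure-left {d} dep pd =
    from T-∨ (inj₁ (from T-∧ (dep , from T-≡ pd))) ,
    from T-∨ (inj₂ (from T-∧ (subst (Departure M) (sym (α1-invol d)) dep ,
                               from T-≡ (trans (cong pos (α1-invol d)) pd))))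

  negative-departure-right : ∀ {d} → Departure M d → pos d ≡ false →
                             RightCorner d × RightCorner (α1 d)
  negative-departure-right {d} dep pd =
    from T-∨ (inj₁ (from T-∧ (dep , from T-not-≡ pd))) ,
    from T-∨ (inj₂ (from T-∧ (subst (Departure M) (sym (α1-invol d)) dep ,
                               from T-not-≡ (trans (cong pos (α1-invol d)) pd))))

  left-right-exclusive : ∀ g → LeftCorner M c g → RightCorner g → ⊥
  left-right-exclusive g left right with to T-∨ left | to T-∨ right
  ... | inj₁ l | inj₁ r = sign-clash {departs? M g} l r
  ... | inj₁ l | inj₂ r = departure-α1-exclusive (proj₁ (to T-∧ l)) (proj₁ (to T-∧ r))
  ... | inj₂ l | inj₁ r = departure-α1-exclusive (proj₁ (to T-∧ r)) (proj₁ (to T-∧ l))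
  ... | inj₂ l | inj₂ r = sign-clash {departs? M (α1 g)} l r

  corners≤flags : ∀ v → leftCount M c v + rightCount M c v ≤ countFlags M (sameVertex? M v)
  corners≤flags v = begin
    leftCount M c v + rightCount M c v                  ≡⟨ count-∨ disjoint (allFin n) ⟨
    count (λ g → atLeft g ∨ atRight g) (allFin n)       ≤⟨ count-mono atVertex (allFin n) ⟩
    countFlags M (sameVertex? M v)                      ∎
    where
    open ≤-Reasoning
    atLeft atRight : Fin n → Bool
    atLeft g = sameVertex? M v g ∧ leftCorner? M c g
    atRight g = sameVertex? M v g ∧ rightCorner? M c g

    disjoint : ∀ g → T (atLeft g) → T (atRight g) → ⊥
    disjoint g l r = left-right-exclusive g (proj₂ (to T-∧ l)) (proj₂ (to T-∧ r))

    atVertex : ∀ g → T (atLeft g ∨ atRight g) → T (sameVertex? M v g)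
    atVertex g h with to (T-∨ {x = atLeft g}) h
    ... | inj₁ l = proj₁ (to T-∧ l)
    ... | inj₂ r = proj₁ (to T-∧ r)

  precubic-flags<8 : Precubic M → ∀ v → countFlags M (sameVertex? M v) < 8
  precubic-flags<8 (degree≡1∨3 , _) v = ≰⇒> λ 8≤flags → ≤⇒≯ degree≤3 (/-monoˡ-≤ 2 8≤flags)
    where
    degree≤3 : degree M v ≤ 3
    degree≤3 with degree≡1∨3 v
    ... | inj₁ degree≡1 = ≤-trans (≤-reflexive degree≡1) (s≤s z≤n)
    ... | inj₂ degree≡3 = ≤-reflexive degree≡3

  module NegativelyFollowedBothWays (pre : Precubic M) (canonical : Canonical M c) {d : Fin n}
           (bothWays : FollowedBothWays d) (negative : pos d ≡ false) where

    rightAtVertex : Fin n → Bool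
    rightAtVertex g = sameVertex? M d g ∧ rightCorner? M c g

    halfEdgeCorners-right : All RightCorner (halfEdgeCorners d)
    halfEdgeCorners-right =
      proj₁ near ∷ proj₂ near ∷ subst RightCorner (α1-invol (α2 d)) (proj₂ far) ∷ proj₁ far ∷ []
      where
      near : RightCorner d × RightCorner (α1 d)
      near = negative-departure-right (proj₁ bothWays) negative
      far : RightCorner (α1 (α2 d)) × RightCorner (α1 (α1 (α2 d)))
      far = negative-departure-right (departure-α1α2 (proj₂ bothWays)) (trans (pos-α1α2 d) negative)

    halfEdgeCorners-rightAtVertex : All (T ∘ rightAtVertex) (halfEdgeCorners d)
    halfEdgeCorners-rightAtVertex =
      All.zipWith (from T-∧) (halfEdgeCorners-sameVertex d , halfEdgeCorners-right)

    -- at a vertex of degree 1 its only corner is a right one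
    not-degree1 : α1 d ≢ α2 d
    not-degree1 α1d≡α2d = <-irrefl refl (begin-strict
      rightCount M c d                      <⟨ canonical d ⟩
      leftCount M c d                       ≤⟨ m≤m+n _ _ ⟩
      leftCount M c d + rightCount M c d    ≤⟨ corners≤flags d ⟩
      countFlags M (sameVertex? M d)        ≤⟨ count-mono onlyRight (allFin n) ⟩
      rightCount M c d                      ∎)
      where
      open ≤-Reasoning
      onlyRight : ∀ g → T (sameVertex? M d g) → T (rightAtVertex g)
      onlyRight g atV with sameVertex-degree1 α1d≡α2d atV
                         | halfEdgeCorners-right
      ... | inj₁ refl | r ∷ _ = from T-∧ (atV , r)
      ... | inj₂ refl | _ ∷ r ∷ _ = from T-∧ (atV , r)

    -- at a vertex with at least two corners, two of at most three are right ones
    impossible : ⊥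
    impossible = <-irrefl refl (begin-strict
      8                                     <⟨ n<1+n 8 ⟩
      5 + 4                                 ≤⟨ +-mono-≤ (≤-trans (s≤s four≤right) (canonical d)) four≤right ⟩
      leftCount M c d + rightCount M c d    ≤⟨ corners≤flags d ⟩
      countFlags M (sameVertex? M d)        <⟨ precubic-flags<8 pre d ⟩
      8                                     ∎)
      where
      open ≤-Reasoning
      four≤right : 4 ≤ rightCount M c d
      four≤right = length≤count _≟_ ∈-allFin (halfEdgeCorners-unique d not-degree1)
                                halfEdgeCorners-rightAtVertex

  followedBothWays-positive : Precubic M → Canonical M c → ∀ {d} → FollowedBothWays d →
                              pos d ≡ true
  followedBothWays-positive pre canonical {d} bothWays with pos d in pd
  ... | true = refl
  ... | false = ⊥-elim (NegativelyFollowedBothWays.impossible pre canonical bothWays pd)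

  positive-halfEdge-left : ∀ {d} → FollowedBothWays d → pos d ≡ true →
                           LeftCorner M c d × LeftCorner M c (α2 d)
  positive-halfEdge-left {d} (dep , dep′) pd =
    proj₁ (positive-departure-left dep pd) ,
    subst (LeftCorner M c) (α1-invol (α2 d))
      (proj₂ (positive-departure-left (departure-α1α2 dep′) (trans (pos-α1α2 d) pd)))

  positive-edge-left : ∀ {d} → FollowedBothWays d → pos d ≡ true → pos (α0 (α2 d)) ≡ true →
                       ∀ {g} → InEdge M d g → LeftCorner M c g
  positive-edge-left bothWays pd pd′ (inj₁ refl) =
    proj₁ (positive-halfEdge-left bothWays pd)
  positive-edge-left {d} bothWays pd pd′ (inj₂ (inj₁ refl)) =
    subst (LeftCorner M c) (α2α0α2≡α0 d)
      (proj₂ (positive-halfEdge-left (followedBothWays-opposite bothWays) pd′))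
  positive-edge-left bothWays pd pd′ (inj₂ (inj₂ (inj₁ refl))) =
    proj₂ (positive-halfEdge-left bothWays pd)
  positive-edge-left bothWays pd pd′ (inj₂ (inj₂ (inj₂ refl))) =
    proj₁ (positive-halfEdge-left (followedBothWays-opposite bothWays) pd′)

  positive-edge-untwisted : ∀ {d} → pos d ≡ true → pos (α0 (α2 d)) ≡ true → ¬ Twist M c d
  positive-edge-untwisted {d} pd pd′ twist
    with trans (sym pd) (trans (sym twist) (trans (pos-α0 d) (cong not pd′)))
  ... | ()

lemma2p2 : (n : ℕ) (M : Map n) → Unicellular M → Precubic M →
           (c : Convention M) → Canonical M c →
           (f : Fin n) → TwoWays M f →
           ((g : Fin n) → InEdge M f g → LeftCorner M c g) × ¬ Twist M c f
lemma2p2 n M _ pre c canonical f twoWays =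
  let open MapProperties M
      open ConventionProperties c
      d , f~d , bothWays = twoWays⇒followedBothWays twoWays
      pd = followedBothWays-positive pre canonical bothWays
      pd′ = followedBothWays-positive pre canonical (followedBothWays-opposite bothWays)
  in (λ g f~g → positive-edge-left bothWays pd pd′ (InEdge-euclidean f~d f~g)) ,
     (λ twist → positive-edge-untwisted pd pd′
                  (InEdge-elim (Twist M c) twist-α0 twist-α2 twist f~d))
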